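{- Let $p$ be a positive integer and let $\lambda$ be a $p$-core partition with bead multiplicities $(b_1,\dots,b_{p-1})$. Then $\ell(\lambda)=\sum_{i=1}^{p-1}b_i$ and \[|\lambda|=\tfrac{1}{2}\ell(\lambda)\bigl(1-\ell(\lambda)-p\bigr)+\tfrac{p}{2}\sum_{i=1}^{p-1}b_i^2+\sum_{i=1}^{p-1}i\,b_i.\]
   Context: A partition is $p$-core if none of its hook lengths is divisible by $p$. $\ell(\lambda)$ is the number of parts of $\lambda$ and $|\lambda|$ its size. The $p$-abacus has runners $0,\dots,p-1$; position $n\ge0$ lies on runner $n\bmod p$ in row $\lfloor n/p\rfloor+1$. A partition $\lambda=(\lambda_1\ge\dots\ge\lambda_\ell>0)$ is represented by beads at positions $\lambda_k+\ell-k$ ($1\le k\le\ell$), all other positions being gaps (so position $0$ is a gap). For a $p$-core partition the beads on each runner occupy the topmost positions of that runner; the $i$-th bead multiplicity $b_i$ ($1\le i\le p-1$) is the number of beads on runner $i$ of this abacus. -}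

module Defs where

open import Data.Nat using (ℕ; zero; suc; _+_; _*_; _∸_; _≤_; _<_; _≥_; _<?_; NonZero)
open import Data.Nat.DivMod using (_%_)
open import Data.Nat.Divisibility using (_∣_)
open import Data.List using (List; []; _∷_; length; filter; map; upTo; lookup)
open import Data.Nat.ListAction using (sum)
open import Data.Product using (_×_)
open import Data.List.Relation.Unary.All using (All)
open import Data.List.Relation.Unary.Linked using (Linked)
open import Data.Fin using (Fin; toℕ)
open import Relation.Nullary using (¬_)
open import Data.Nat using (_≟_)

IsPartition : List ℕ → Set
IsPartition la = Linked _≥_ la × All (λ x → 0 < x) la

ℓ : List ℕ → ℕ
ℓ = length

size : List ℕ → ℕ
size = sum

-- length of column j (0-indexed): λ'_{j+1} = #{k : λ_k > j}
colLen : List ℕ → ℕ → ℕ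
colLen la j = length (filter (j <?_) la)

-- hook length of the cell in row i, column j (both 0-indexed; cell exists iff j < λ_i)
-- arm = λ_i - j - 1, leg = λ'_j - i - 1, hook = arm + leg + 1
hookLen : (la : List ℕ) → Fin (length la) → ℕ → ℕ
hookLen la i j = ((lookup la i ∸ j) ∸ 1) + ((colLen la j ∸ toℕ i) ∸ 1) + 1

IsCore : ℕ → List ℕ → Set
IsCore p la = (i : Fin (length la)) (j : ℕ) → j < lookup la i → ¬ (p ∣ hookLen la i j)

-- bead positions λ_k + ℓ - k (k = 1..ℓ); for λ_k this is λ_k + (number of parts after λ_k)
beads : List ℕ → List ℕ
beads [] = []
beads (x ∷ xs) = (x + length xs) ∷ beads xs

mult : (p : ℕ) .{{_ : NonZero p}} → List ℕ → ℕ → ℕ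
mult p la i = length (filter (λ n → n % p ≟ i) (beads la))

runners : ℕ → List ℕ
runners p = map suc (upTo (p ∸ 1))

{-# OPTIONS --safe #-}
-- Induction on the number of parts, removing the largest part λ₁. The other beads do not move,
-- and the bead of λ₁ sits at t = λ₁ + ℓ - 1 = r + q p on runner r. Every gap m < t yields a
-- first-row hook of length t - m; since λ is a p-core, all of r, r + p, …, r + (q-1) p
-- are therefore beads. So b_r drops from q + 1 to q and the other b_i stay put, and r ≠ 0 because
-- position 0 is a gap. Both identities now follow by comparing the changes: ℓ and Σ bᵢ drop by 1,
-- Σ bᵢ² by 2q + 1, Σ i bᵢ by r, and |λ| by λ₁ = r + q p - (ℓ - 1).
module Submission where

open import Defs

module Abacus where

  open import Data.Nat
  open import Data.Nat.Properties
  open import Data.Nat.DivMod using (_%_; _/_; m≡m%n+[m/n]*n; m%n<n; [m+kn]%n≡m%n; m<n⇒m%n≡m)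
  open import Data.Nat.Divisibility using (_∣_; ∣m+n∣m⇒∣n; n∣m*n)
  open import Data.Nat.ListAction using (sum)
  open import Data.Nat.Tactic.RingSolver using (solve-∀)
  open import Data.List using (List; []; _∷_; length; filter; map)
  open import Data.List.Properties using (filter-accept; filter-reject; filter-none; map-cong-local)
  open import Data.List.Membership.Propositional using (_∈_; _∉_)
  open import Data.List.Membership.Propositional.Properties using (∈-map⁺; ∈-upTo⁺)
  open import Data.List.Membership.DecPropositional _≟_ using (_∈?_)
  open import Data.List.Relation.Unary.All as All using (All; []; _∷_)
  open import Data.List.Relation.Unary.AllPairs as AllPairs using ([]; _∷_)
  open import Data.List.Relation.Unary.Any using (here; there)
  open import Data.List.Relation.Unary.Linked as Linked using (Linked; []; [-]; _∷_)
  open import Data.List.Relation.Unary.Linked.Properties using (Linked⇒All; Linked⇒AllPairs)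
  open import Data.List.Relation.Unary.Unique.Propositional using (Unique)
  open import Data.List.Relation.Unary.Unique.Propositional.Properties using (map⁺; upTo⁺)
  open import Data.Fin using (zero; suc)
  open import Data.Product using (∃-syntax; _×_; _,_)
  open import Function using (_∘_)
  open import Relation.Binary.Definitions using (Transitive; tri<; tri≈; tri>)
  open import Relation.Binary.PropositionalEquality
  open import Relation.Nullary using (yes; no; contradiction)

  ≥-trans : Transitive _≥_
  ≥-trans m≥n n≥o = ≤-trans n≥o m≥n

  >-trans : Transitive _>_
  >-trans m>n n>o = <-trans n>o m>n

  linked-head : ∀ {A : Set} {R : A → A → Set} → Transitive R → ∀ {x xs} → Linked R (x ∷ xs) → All (R x) xs
  linked-head trans = AllPairs.head ∘ Linked⇒AllPairs trans

  sum-map-bump : ∀ {r d} {f g : ℕ → ℕ} {L} → Unique L → r ∈ L →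
    (∀ {i} → i ≢ r → g i ≡ f i) → g r ≡ f r + d → sum (map g L) ≡ sum (map f L) + d
  sum-map-bump {d = d} {f} {g} {i ∷ L} (i∉L ∷ _) (here refl) agree bump = begin
    g i + sum (map g L)       ≡⟨ cong₂ _+_ bump (cong sum (map-cong-local (All.map (agree ∘ ≢-sym) i∉L))) ⟩
    f i + d + sum (map f L)   ≡⟨ +-assoc (f i) d _ ⟩
    f i + (d + sum (map f L)) ≡⟨ cong (f i +_) (+-comm d _) ⟩
    f i + (sum (map f L) + d) ≡⟨ +-assoc (f i) _ d ⟨
    f i + sum (map f L) + d   ∎
    where open ≡-Reasoning
  sum-map-bump {d = d} {f} {g} {i ∷ L} (i∉L ∷ uL) (there r∈L) agree bump = begin
    g i + sum (map g L)       ≡⟨ cong₂ _+_ (agree (All.lookup i∉L r∈L)) (sum-map-bump uL r∈L agree bump) ⟩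
    f i + (sum (map f L) + d) ≡⟨ +-assoc (f i) _ d ⟨
    f i + sum (map f L) + d   ∎
    where open ≡-Reasoning

  suc-square : ∀ n → suc n * suc n ≡ n * n + (2 * n + 1)
  suc-square = solve-∀

  sum-map-≡0 : ∀ {f : ℕ → ℕ} L → (∀ i → f i ≡ 0) → sum (map f L) ≡ 0
  sum-map-≡0 [] _ = refl
  sum-map-≡0 (i ∷ L) f≡0 = cong₂ _+_ (f≡0 i) (sum-map-≡0 L f≡0)

  runners-unique : ∀ p → Unique (runners p)
  runners-unique p = map⁺ suc-injective (upTo⁺ (p ∸ 1))

  ∈-runners : ∀ {p r} → 0 < r → r < p → r ∈ runners p
  ∈-runners {suc p} {suc r} _ (s<s r<p) = ∈-map⁺ suc (∈-upTo⁺ r<p)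

  colLen-≤ : ∀ {j} ys → All (_≤ j) ys → colLen ys j ≡ 0
  colLen-≤ {j} ys ys≤j = cong length (filter-none (j <?_) (All.map ≤⇒≯ ys≤j))

  colLen-∷ : ∀ {j y} ys → j < y → colLen (y ∷ ys) j ≡ suc (colLen ys j)
  colLen-∷ {j} ys j<y = cong length (filter-accept (j <?_) j<y)

  column-below-head : ∀ {y ys j m} → Linked _≥_ (y ∷ ys) →
    j + length ys ≡ m + colLen ys j → m < y + length ys → j < y
  column-below-head {y} {ys} {j} {m} y∷ys↘ eq m<t with j <? y
  ... | yes j<y = j<y
  ... | no j≮y = contradiction m<t (≤⇒≯ (begin
    y + length ys   ≤⟨ +-monoˡ-≤ (length ys) y≤j ⟩
    j + length ys   ≡⟨ eq ⟩
    m + colLen ys j ≡⟨ cong (m +_) (colLen-≤ ys (All.tail (Linked⇒All ≥-trans y≤j y∷ys↘))) ⟩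
    m + 0           ≡⟨ +-identityʳ m ⟩
    m               ∎))
    where
    open ≤-Reasoning
    y≤j : y ≤ j
    y≤j = ≮⇒≥ j≮y

  column-of-gap : ∀ {ys m} → Linked _≥_ ys → m ∉ beads ys → ∃[ j ] j + length ys ≡ m + colLen ys j
  column-of-gap {[]} {m} _ _ = m , refl
  column-of-gap {y ∷ ys} {m} y∷ys↘ m∉ with <-cmp m (y + length ys)
  ... | tri≈ _ m≡t _ = contradiction (here m≡t) m∉
  ... | tri< m<t _ _ with column-of-gap (Linked.tail y∷ys↘) (m∉ ∘ there)
  ...   | j , eq = j , (begin
    j + suc (length ys)   ≡⟨ +-suc j _ ⟩
    suc (j + length ys)   ≡⟨ cong suc eq ⟩
    suc (m + colLen ys j) ≡⟨ +-suc m _ ⟨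
    m + suc (colLen ys j) ≡⟨ cong (m +_) (colLen-∷ ys (column-below-head y∷ys↘ eq m<t)) ⟨
    m + colLen (y ∷ ys) j ∎)
    where open ≡-Reasoning
  column-of-gap {y ∷ ys} {m} y∷ys↘ m∉ | tri> _ _ t<m =
    m ∸ L , trans (m∸n+n≡m L≤m) (sym (trans (cong (m +_) colLen≡0) (+-identityʳ m)))
    where
    L : ℕ
    L = length (y ∷ ys)
    y+L≤m : y + L ≤ m
    y+L≤m = subst (_≤ m) (sym (+-suc y (length ys))) t<m
    L≤m : L ≤ m
    L≤m = m+n≤o⇒n≤o y y+L≤m
    colLen≡0 : colLen (y ∷ ys) (m ∸ L) ≡ 0
    colLen≡0 = colLen-≤ (y ∷ ys) (Linked⇒All ≥-trans (m+n≤o⇒m≤o∸n y y+L≤m) y∷ys↘)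

  firstRow-hookLen : ∀ {x xs j} → j < x → hookLen (x ∷ xs) zero j + j ≡ x + colLen xs j
  firstRow-hookLen {x} {xs} {j} j<x rewrite colLen-∷ xs j<x = begin
    x ∸ j ∸ 1 + c + 1 + j     ≡⟨ shuffle (x ∸ j ∸ 1) c j ⟩
    x ∸ j ∸ 1 + (j + 1) + c   ≡⟨ cong (λ a → a + (j + 1) + c) (∸-+-assoc x j 1) ⟩
    x ∸ (j + 1) + (j + 1) + c ≡⟨ cong (_+ c) (m∸n+n≡m (subst (_≤ x) (+-comm 1 j) j<x)) ⟩
    x + c                     ∎
    where
    open ≡-Reasoning
    c : ℕ
    c = colLen xs j
    shuffle : ∀ a c j → a + c + 1 + j ≡ a + (j + 1) + c
    shuffle = solve-∀

  gap-hook : ∀ {x xs m} → Linked _≥_ (x ∷ xs) → m ∉ beads xs → m < x + length xs →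
    ∃[ j ] j < x × hookLen (x ∷ xs) zero j + m ≡ x + length xs
  gap-hook {x} {xs} {m} x∷xs↘ m∉ m<t with column-of-gap (Linked.tail x∷xs↘) m∉
  ... | j , eq = j , j<x , +-cancelʳ-≡ c _ _ (begin
    h + m + c     ≡⟨ +-assoc h m c ⟩
    h + (m + c)   ≡⟨ cong (h +_) eq ⟨
    h + (j + L)   ≡⟨ +-assoc h j L ⟨
    h + j + L     ≡⟨ cong (_+ L) (firstRow-hookLen j<x) ⟩
    x + c + L     ≡⟨ +-assoc x c L ⟩
    x + (c + L)   ≡⟨ cong (x +_) (+-comm c L) ⟩
    x + (L + c)   ≡⟨ +-assoc x L c ⟨
    x + L + c     ∎)
    where
    open ≡-Reasoning
    L c h : ℕ
    L = length xs
    c = colLen xs j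
    h = hookLen (x ∷ xs) zero j
    j<x : j < x
    j<x = column-below-head x∷xs↘ eq m<t

  hookLen-∷ : ∀ {x xs i j} → j < x → hookLen (x ∷ xs) (suc i) j ≡ hookLen xs i j
  hookLen-∷ {xs = xs} j<x rewrite colLen-∷ xs j<x = refl

  IsCore-tail : ∀ {p x xs} → Linked _≥_ (x ∷ xs) → IsCore p (x ∷ xs) → IsCore p xs
  IsCore-tail {p} {x} x∷xs↘ core i j j<λᵢ p∣h = core (suc i) j j<λᵢ (subst (p ∣_) (sym (hookLen-∷ j<x)) p∣h)
    where
    j<x : j < x
    j<x = <-≤-trans j<λᵢ (Linked.lookup ≥-trans (Linked.tail x∷xs↘) (Linked.head′ x∷xs↘) i)

  IsPartition-tail : ∀ {x xs} → IsPartition (x ∷ xs) → IsPartition xs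
  IsPartition-tail (x∷xs↘ , _ ∷ xs>0) = Linked.tail x∷xs↘ , xs>0

  beads-decreasing : ∀ {la} → Linked _≥_ la → Linked _>_ (beads la)
  beads-decreasing [] = []
  beads-decreasing [-] = [-]
  beads-decreasing {x ∷ y ∷ zs} (x≥y ∷ y∷zs↘) =
    subst (y + length zs <_) (sym (+-suc x (length zs))) (s≤s (+-monoˡ-≤ (length zs) x≥y))
    ∷ beads-decreasing y∷zs↘

  beads-positive : ∀ {la} → All (0 <_) la → All (0 <_) (beads la)
  beads-positive {[]} [] = []
  beads-positive {x ∷ xs} (x>0 ∷ xs>0) = <-≤-trans x>0 (m≤m+n x (length xs)) ∷ beads-positive xs>0

  ∈-∷-below : ∀ {z y L} → z < y → z ∈ y ∷ L → z ∈ L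
  ∈-∷-below z<y (here z≡y) = contradiction z≡y (<⇒≢ z<y)
  ∈-∷-below _ (there z∈L) = z∈L

  module _ {p : ℕ} .{{_ : NonZero p}} where

    runner-< : ∀ {r a b} → r + a * p < r + b * p → a < b
    runner-< {r} {a} {b} lt = *-cancelʳ-< p a b (+-cancelˡ-< r _ _ lt)

    onRunner : ∀ {y r} → y % p ≡ r → y ≡ r + (y / p) * p
    onRunner {y} y↦r = trans (m≡m%n+[m/n]*n y p) (cong (_+ (y / p) * p) y↦r)

    sameRunner⇒∣ : ∀ {h r k q} → h + (r + k * p) ≡ r + q * p → p ∣ h
    sameRunner⇒∣ {h} {r} {k} {q} eq = ∣m+n∣m⇒∣n (subst (p ∣_) (sym kp+h≡qp) (n∣m*n q)) (n∣m*n k)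
      where
      swap : ∀ h r kp → r + (kp + h) ≡ h + (r + kp)
      swap = solve-∀
      kp+h≡qp : k * p + h ≡ q * p
      kp+h≡qp = +-cancelˡ-≡ r _ _ (trans (swap h r (k * p)) eq)

    runner-mono : ∀ {r a b} → a < b → r + a * p < r + b * p
    runner-mono {r} a<b = +-monoʳ-< r (*-monoˡ-< p a<b)

    runner-mod : ∀ {r k} → r < p → (r + k * p) % p ≡ r
    runner-mod {r} {k} r<p = trans ([m+kn]%n≡m%n r k p) (m<n⇒m%n≡m r<p)

    runner-top : ∀ {r q y L} → y % p ≡ r → y < r + q * p → All (_< y) L →
      (∀ {k} → k < q → r + k * p ∈ y ∷ L) → ∃[ q′ ] q ≡ suc q′ × y ≡ r + q′ * p
    runner-top {r} {zero} {y} y↦r y<r _ _ =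
      contradiction y<r (≤⇒≯ (subst (r + 0 ≤_) (sym (onRunner y↦r)) (+-monoʳ-≤ r z≤n)))
    runner-top {r} {suc q′} {y} y↦r y<bound L<y full with full {q′} ≤-refl
    ... | here r+q′p≡y = q′ , refl , sym r+q′p≡y
    ... | there ∈L = contradiction q′<d (≤⇒≯ d≤q′)
      where
      q′<d : q′ < y / p
      q′<d = runner-< {r} (subst (r + q′ * p <_) (onRunner y↦r) (All.lookup L<y ∈L))
      d≤q′ : y / p ≤ q′
      d≤q′ = ≤-pred (runner-< {r} (subst (_< r + suc q′ * p) (onRunner y↦r) y<bound))

    runner-count : ∀ {r q} → r < p → ∀ L → Linked _>_ L → All (_< r + q * p) L →
      (∀ {k} → k < q → r + k * p ∈ L) → length (filter (λ n → n % p ≟ r) L) ≡ q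
    runner-count {q = zero} _ [] _ _ _ = refl
    runner-count {r} {suc q} _ [] _ _ full = contradiction (full {0} z<s) λ ()
    runner-count {r} {q} r<p (y ∷ L) y∷L↘ (y<bound ∷ L<bound) full with y % p ≟ r
    ... | no y↛r = trans (cong length (filter-reject (λ n → n % p ≟ r) y↛r))
                         (runner-count r<p L (Linked.tail y∷L↘) L<bound full′)
      where
      full′ : ∀ {k} → k < q → r + k * p ∈ L
      full′ {k} k<q with full k<q
      ... | here r+kp≡y = contradiction (trans (cong (_% p) (sym r+kp≡y)) (runner-mod {k = k} r<p)) y↛r
      ... | there ∈L = ∈L
    ... | yes y↦r with runner-top y↦r y<bound (linked-head >-trans y∷L↘) full
    ...   | q′ , refl , y≡ = trans (cong length (filter-accept (λ n → n % p ≟ r) y↦r))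
      (cong suc (runner-count r<p L (Linked.tail y∷L↘)
                              (subst (λ b → All (_< b) L) y≡ (linked-head >-trans y∷L↘)) full′))
      where
      full′ : ∀ {k} → k < q′ → r + k * p ∈ L
      full′ k<q′ = ∈-∷-below (subst (_ <_) (sym y≡) (runner-mono {r} k<q′)) (full (m<n⇒m<1+n k<q′))

    topRunner topRow : ℕ → List ℕ → ℕ
    topRunner x xs = (x + length xs) % p
    topRow x xs = (x + length xs) / p

    top-decomposition : ∀ x xs → x + length xs ≡ topRunner x xs + topRow x xs * p
    top-decomposition x xs = m≡m%n+[m/n]*n (x + length xs) p

    below-top : ∀ x xs {k} → k < topRow x xs → topRunner x xs + k * p < x + length xs
    below-top x xs {k} k<q = subst (topRunner x xs + k * p <_) (sym (top-decomposition x xs)) (runner-mono k<q)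

    topRunner-filled : ∀ {x xs} → Linked _≥_ (x ∷ xs) → IsCore p (x ∷ xs) →
      ∀ {k} → k < topRow x xs → topRunner x xs + k * p ∈ beads xs
    topRunner-filled {x} {xs} x∷xs↘ core {k} k<q with topRunner x xs + k * p ∈? beads xs
    ... | yes ∈xs = ∈xs
    ... | no ∉xs with gap-hook x∷xs↘ ∉xs (below-top x xs k<q)
    ...   | j , j<x , h+m≡t = contradiction
      (sameRunner⇒∣ {k = k} {topRow x xs} (trans h+m≡t (top-decomposition x xs))) (core zero j j<x)

    topRunner-positive : ∀ {x xs} → IsPartition (x ∷ xs) → IsCore p (x ∷ xs) → 0 < topRunner x xs
    topRunner-positive {x} {xs} (x∷xs↘ , x>0 ∷ xs>0) core with topRunner x xs ≟ 0
    ... | no r≢0 = n≢0⇒n>0 r≢0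
    ... | yes r≡0 = contradiction (All.lookup (beads-positive xs>0) (topRunner-filled x∷xs↘ core 0<q))
                                  (λ 0<r+0 → <⇒≢ 0<r+0 (sym (trans (+-identityʳ _) r≡0)))
      where
      0<q : 0 < topRow x xs
      0<q = n≢0⇒n>0 λ q≡0 → <⇒≢ (<-≤-trans x>0 (m≤m+n x (length xs)))
        (sym (trans (top-decomposition x xs) (cong₂ (λ a b → a + b * p) r≡0 q≡0)))

    mult-topRunner : ∀ {x xs} → Linked _≥_ (x ∷ xs) → IsCore p (x ∷ xs) →
      mult p xs (topRunner x xs) ≡ topRow x xs
    mult-topRunner {x} {xs} x∷xs↘ core = runner-count (m%n<n _ p) (beads xs) (Linked.tail t∷B↘)
      (subst (λ b → All (_< b) (beads xs)) (top-decomposition x xs) (linked-head >-trans t∷B↘))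
      (topRunner-filled x∷xs↘ core)
      where
      t∷B↘ : Linked _>_ (beads (x ∷ xs))
      t∷B↘ = beads-decreasing x∷xs↘

    mult-∷-≢ : ∀ {x xs i} → topRunner x xs ≢ i → mult p (x ∷ xs) i ≡ mult p xs i
    mult-∷-≢ {i = i} ne = cong length (filter-reject (λ n → n % p ≟ i) ne)

    mult-∷-top : ∀ {x xs} → mult p (x ∷ xs) (topRunner x xs) ≡ suc (mult p xs (topRunner x xs))
    mult-∷-top {x} {xs} = cong length (filter-accept (λ n → n % p ≟ topRunner x xs) refl)

    runnerSum-∷ : ∀ {x xs} → IsPartition (x ∷ xs) → IsCore p (x ∷ xs) →
      (f : ℕ → ℕ → ℕ) {d : ℕ} →
      f (topRunner x xs) (suc (topRow x xs)) ≡ f (topRunner x xs) (topRow x xs) + d →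
      sum (map (λ i → f i (mult p (x ∷ xs) i)) (runners p))
        ≡ sum (map (λ i → f i (mult p xs i)) (runners p)) + d
    runnerSum-∷ {x} {xs} part@(x∷xs↘ , _) core f {d} bump =
      sum-map-bump (runners-unique p) (∈-runners (topRunner-positive part core) (m%n<n _ p))
        (λ i≢r → cong (f _) (mult-∷-≢ (≢-sym i≢r))) (begin
          f r (mult p (x ∷ xs) r) ≡⟨ cong (f r) mult-∷-top ⟩
          f r (suc (mult p xs r)) ≡⟨ cong (f r ∘ suc) b≡q ⟩
          f r (suc q)             ≡⟨ bump ⟩
          f r q + d               ≡⟨ cong (λ b → f r b + d) b≡q ⟨
          f r (mult p xs r) + d   ∎)
      where
      open ≡-Reasoning
      r q : ℕ
      r = topRunner x xs
      q = topRow x xs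
      b≡q : mult p xs r ≡ q
      b≡q = mult-topRunner x∷xs↘ core

open Abacus

open import Data.Nat using (ℕ; NonZero)
open import Data.Nat using () renaming (_*_ to _*ℕ_)
open import Data.List using (List; map)
open import Data.Nat.ListAction using (sum)
open import Data.Integer using (ℤ; +_; _+_; _-_; _*_)
open import Data.Product using (_×_)
open import Relation.Binary.PropositionalEquality using (_≡_)

import Data.Nat as ℕ
import Data.Nat.Properties as ℕₚ
open import Data.Integer.Properties using (pos-+; pos-*)
open import Data.Integer.Tactic.RingSolver using (solve-∀)
open import Data.List using ([]; _∷_)
open import Data.Product using (_,_)
open import Relation.Binary.PropositionalEquality using (refl; sym; trans; cong; cong₂; module ≡-Reasoning)

twiceSizeFormula : ℤ → ℤ → ℤ → ℤ → ℤ
twiceSizeFormula p l S T = l * ((+ 1 - l) - p) + p * S + (+ 2) * T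

twiceSizeFormula-step : ∀ p l S T x s q r → (+ 2) * s ≡ twiceSizeFormula p l S T → x + l ≡ r + q * p →
  (+ 2) * (x + s) ≡ twiceSizeFormula p (+ 1 + l) (S + ((+ 2) * q + + 1)) (T + r)
twiceSizeFormula-step p l S T x s q r 2s≡ x+l≡ = begin
  (+ 2) * (x + s)                                        ≡⟨ split x s l ⟩
  (+ 2) * s + (+ 2) * ((x + l) - l)                      ≡⟨ cong₂ (λ a b → a + (+ 2) * (b - l)) 2s≡ x+l≡ ⟩
  twiceSizeFormula p l S T + (+ 2) * ((r + q * p) - l)   ≡⟨ grow p l S T q r ⟩
  twiceSizeFormula p (+ 1 + l) (S + ((+ 2) * q + + 1)) (T + r) ∎
  where
  open ≡-Reasoning
  split : ∀ x s l → (+ 2) * (x + s) ≡ (+ 2) * s + (+ 2) * ((x + l) - l)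
  split = solve-∀
  grow : ∀ p l S T q r →
    l * ((+ 1 - l) - p) + p * S + (+ 2) * T + (+ 2) * ((r + q * p) - l)
      ≡ (+ 1 + l) * ((+ 1 - (+ 1 + l)) - p) + p * (S + ((+ 2) * q + + 1)) + (+ 2) * (T + r)
  grow = solve-∀

length≡runnerSum : ∀ p .{{_ : NonZero p}} la → IsPartition la → IsCore p la →
  ℓ la ≡ sum (map (mult p la) (runners p))
length≡runnerSum p [] _ _ = sym (sum-map-≡0 (runners p) (λ _ → refl))
length≡runnerSum p (x ∷ xs) part@(x∷xs↘ , _) core = begin
  ℕ.suc (ℓ xs)                                ≡⟨ cong ℕ.suc ih ⟩
  ℕ.suc (sum (map (mult p xs) (runners p)))   ≡⟨ ℕₚ.+-comm 1 _ ⟩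
  sum (map (mult p xs) (runners p)) ℕ.+ 1     ≡⟨ runnerSum-∷ part core (λ _ b → b) (ℕₚ.+-comm 1 _) ⟨
  sum (map (mult p (x ∷ xs)) (runners p))     ∎
  where
  open ≡-Reasoning
  ih : ℓ xs ≡ sum (map (mult p xs) (runners p))
  ih = length≡runnerSum p xs (IsPartition-tail part) (IsCore-tail x∷xs↘ core)

squareSum weightedSum : (p : ℕ) .{{_ : NonZero p}} → List ℕ → ℕ
squareSum p la = sum (map (λ i → mult p la i *ℕ mult p la i) (runners p))
weightedSum p la = sum (map (λ i → i *ℕ mult p la i) (runners p))

twiceSize≡formula : ∀ p .{{_ : NonZero p}} la → IsPartition la → IsCore p la →
  (+ 2) * (+ size la) ≡ twiceSizeFormula (+ p) (+ ℓ la) (+ squareSum p la) (+ weightedSum p la)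
twiceSize≡formula p [] _ _ = trans (emptyFormula (+ p)) (cong₂ (λ S T → twiceSizeFormula (+ p) (+ 0) (+ S) (+ T))
  (sym (sum-map-≡0 (runners p) (λ _ → refl))) (sym (sum-map-≡0 (runners p) ℕₚ.*-zeroʳ)))
  where
  emptyFormula : ∀ P → (+ 2) * (+ 0) ≡ (+ 0) * ((+ 1 - + 0) - P) + P * (+ 0) + (+ 2) * (+ 0)
  emptyFormula = solve-∀
twiceSize≡formula p (x ∷ xs) part@(x∷xs↘ , _) core = begin
  (+ 2) * (+ (x ℕ.+ size xs))   ≡⟨ cong ((+ 2) *_) (pos-+ x (size xs)) ⟩
  (+ 2) * (+ x + + size xs)     ≡⟨ twiceSizeFormula-step (+ p) (+ ℓ xs) (+ squareSum p xs) (+ weightedSum p xs)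
                                     (+ x) (+ size xs) (+ q) (+ r) ih x+l≡ ⟩
  twiceSizeFormula (+ p) (+ 1 + + ℓ xs) (+ squareSum p xs + ((+ 2) * (+ q) + + 1)) (+ weightedSum p xs + + r)
                                ≡⟨ cong₂ (twiceSizeFormula (+ p) (+ ℕ.suc (ℓ xs))) squares weights ⟨
  twiceSizeFormula (+ p) (+ ℓ (x ∷ xs)) (+ squareSum p (x ∷ xs)) (+ weightedSum p (x ∷ xs)) ∎
  where
  open ≡-Reasoning
  r q : ℕ
  r = topRunner x xs
  q = topRow x xs
  ih : (+ 2) * (+ size xs) ≡ twiceSizeFormula (+ p) (+ ℓ xs) (+ squareSum p xs) (+ weightedSum p xs)
  ih = twiceSize≡formula p xs (IsPartition-tail part) (IsCore-tail x∷xs↘ core)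
  x+l≡ : + x + + ℓ xs ≡ + r + + q * + p
  x+l≡ = trans (cong +_ (top-decomposition x xs)) (cong (λ z → + r + z) (pos-* q p))
  squares : + squareSum p (x ∷ xs) ≡ + squareSum p xs + ((+ 2) * (+ q) + + 1)
  squares = trans (cong +_ (runnerSum-∷ part core (λ _ b → b *ℕ b) (suc-square q)))
                  (cong (λ z → + squareSum p xs + (z + + 1)) (pos-* 2 q))
  weights : + weightedSum p (x ∷ xs) ≡ + weightedSum p xs + + r
  weights = cong +_ (runnerSum-∷ part core (λ i b → i *ℕ b) (trans (ℕₚ.*-suc r q) (ℕₚ.+-comm r _)))

lemma2p2 : (p : ℕ) .{{_ : NonZero p}} (la : List ℕ) → IsPartition la → IsCore p la →
    (ℓ la ≡ sum (map (mult p la) (runners p)))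
    × ((+ 2) * (+ size la)
        ≡ (+ ℓ la) * ((+ 1 - + ℓ la) - + p)
          + (+ p) * (+ sum (map (λ i → mult p la i *ℕ mult p la i) (runners p)))
          + (+ 2) * (+ sum (map (λ i → i *ℕ mult p la i) (runners p))))
lemma2p2 p la part core = length≡runnerSum p la part core , twiceSize≡formula p la part core
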